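{- Let $N\ge 3$ be odd and let $m=\frac{N-1}{2}$. Let $H_{N+1}$ be the $(m+1)\times(m+1)$ matrix with entries \[ H_{N+1}(i,j)=\begin{cases} 3 & \text{if } i=j,\ i\notin\{m,m+1\},\\ 2 & \text{if } i=j=m,\\ N & \text{if } i=j=m+1,\\ -1 & \text{if } |i-j|=1 \text{ and } (i,j)\neq(m+1,m),\ \text{or if } j=m+1,\ 1\le i\le m,\\ -2 & \text{if } i=m+1,\ 1\le j\le m,\\ 0 & \text{otherwise}. \end{cases} \] Then $H_{N+1}$ is invertible and \[ H_{N+1}^{ -1}(i,j)=\frac{1}{F_{N-1}+F_{N+1}}\begin{cases} 2(F_N-F_{N-2i})+F_{N-2j}(L_{2i}-2) & \text{if } 1\le i<j\le m,\\ 2(F_N-F_{N-2j})+F_{N-2i}(L_{2j}-2) & \text{if } 1\le j\le i\le m,\\ 2(F_N-F_{N-2j}) & \text{if } i=m+1,\ 1\le j\le m,\\ F_N-F_{N-2i} & \text{if } j=m+1,\ 1\le i\le m,\\ F_N & \text{if } i=j=m+1. \end{cases} \]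
   Context: $F_n$ denotes the Fibonacci numbers ($F_0=0$, $F_1=1$, $F_{n+2}=F_{n+1}+F_n$) and $L_n$ the Lucas numbers ($L_0=2$, $L_1=1$, $L_{n+2}=L_{n+1}+L_n$), extended to negative indices by the same recurrence. -}

module Defs where

open import Data.Nat as ℕ using (ℕ; zero; suc; _∸_; _≡ᵇ_; _<ᵇ_; _≤ᵇ_; NonZero)
import Data.Nat.Properties as ℕP
open import Data.Bool using (Bool; true; false; if_then_else_; _∧_; _∨_; not)
open import Data.Fin using (Fin; toℕ)
import Data.Fin as Fin
open import Data.Integer as ℤ using (ℤ; +_)
open import Data.Rational as ℚ using (ℚ; 0ℚ; 1ℚ; _+_; _*_; _-_; -_)

-- Fibonacci and Lucas numbers (only nonnegative indices are needed below,
-- since all indices N-2i, N-2j, 2i, 2j occurring are ≥ 0 for 1 ≤ i,j ≤ m).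
F : ℕ → ℕ
F 0 = 0
F 1 = 1
F (suc (suc n)) = F (suc n) ℕ.+ F n

L : ℕ → ℕ
L 0 = 2
L 1 = 1
L (suc (suc n)) = L (suc n) ℕ.+ L n

F-suc-nonZero : ∀ n → NonZero (F (suc n))
F-suc-nonZero zero = _
F-suc-nonZero (suc n) with F (suc n) | F-suc-nonZero n
... | suc k | _ = _

den-nonZero : ∀ N → NonZero (F (N ∸ 1) ℕ.+ F (suc N))
den-nonZero N with F (suc N) | F-suc-nonZero N
... | suc k | _ = ℕ.>-nonZero (ℕP.<-≤-trans (ℕ.s≤s ℕ.z≤n) (ℕP.m≤n+m (suc k) (F (N ∸ 1))))

qN : ℕ → ℚ
qN n = (+ n) ℚ./ 1

qZ : ℤ → ℚ
qZ z = z ℚ./ 1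

Matrix : ℕ → Set
Matrix n = Fin n → Fin n → ℚ

∑ : ∀ {n} → (Fin n → ℚ) → ℚ
∑ {zero} f = 0ℚ
∑ {suc n} f = f Fin.zero + ∑ (λ i → f (Fin.suc i))

_⊗_ : ∀ {n} → Matrix n → Matrix n → Matrix n
(A ⊗ B) i j = ∑ (λ k → A i k * B k j)

Id : ∀ {n} → Matrix n
Id i j = if toℕ i ≡ᵇ toℕ j then 1ℚ else 0ℚ

-- Entries of H_{N+1} with 1-based indices a = row, b = column, 1 ≤ a,b ≤ m+1.
Hentry : (m N a b : ℕ) → ℚ
Hentry m N a b =
  if (a ≡ᵇ b) ∧ not (a ≡ᵇ m) ∧ not (a ≡ᵇ suc m) then qN 3
  else if (a ≡ᵇ b) ∧ (a ≡ᵇ m) then qN 2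
  else if (a ≡ᵇ b) ∧ (a ≡ᵇ suc m) then qN N
  else if ((suc a ≡ᵇ b) ∨ (suc b ≡ᵇ a)) ∧ not ((a ≡ᵇ suc m) ∧ (b ≡ᵇ m)) then - 1ℚ
  else if (b ≡ᵇ suc m) ∧ (1 ≤ᵇ a) ∧ (a ≤ᵇ m) then - 1ℚ
  else if (a ≡ᵇ suc m) ∧ (1 ≤ᵇ b) ∧ (b ≤ᵇ m) then - qN 2
  else 0ℚ

H : (m N : ℕ) → Matrix (suc m)
H m N i j = Hentry m N (suc (toℕ i)) (suc (toℕ j))

Centry : (m N a b : ℕ) → ℚ
Centry m N a b =
  if (a ≡ᵇ suc m) ∧ (b ≡ᵇ suc m) then qN (F N)
  else if (a ≡ᵇ suc m) then qN 2 * (qN (F N) - qN (F (N ∸ 2 ℕ.* b)))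
  else if (b ≡ᵇ suc m) then qN (F N) - qN (F (N ∸ 2 ℕ.* a))
  else if a <ᵇ b
    then qN 2 * (qN (F N) - qN (F (N ∸ 2 ℕ.* a))) + qN (F (N ∸ 2 ℕ.* b)) * (qN (L (2 ℕ.* a)) - qN 2)
    else qN 2 * (qN (F N) - qN (F (N ∸ 2 ℕ.* b))) + qN (F (N ∸ 2 ℕ.* a)) * (qN (L (2 ℕ.* b)) - qN 2)

Hinv : (m N : ℕ) → Matrix (suc m)
Hinv m N i j =
  ((+ 1) ℚ./ (F (N ∸ 1) ℕ.+ F (suc N))) {{den-nonZero N}}
    * Centry m N (suc (toℕ i)) (suc (toℕ j))

-- Extend every column c of C by c 0 = 0, which is what the closed formula gives.  For 1 ≤ a < m, row a of
-- H acts on c as the stencil 3 c(a) - c(a-1) - c(a+1) followed by subtracting the last entry c(m+1); the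
-- stencil kills φ k = F(N-2k) and Λ k = L(2k), both solutions of y(k) + y(k+2) = 3 y(k+1).  Away from the
-- diagonal, column b of C is an affine combination of φ and Λ whose constant term is its last entry, so
-- these rows give 0; on the diagonal they give the Casoratian φ b Λ(b+1) - φ(b+1) Λ b, which is constant
-- and equals L N = F(N-1) + F(N+1).  Row m is the same computation with the boundary values φ(m-1) = 2 and
-- φ m = 1.  Summing rows 1..m telescopes, which expresses row m+1 of H·C through the others, and
-- L N = 3 F N - 2 F(N-2) settles it.  Finally H and C become symmetric once their last columns are
-- doubled, and this turns H·C = L N · Id into C·H = L N · Id.
module Submission where

open import Defs
open import Algebra.Bundles using (CommutativeMonoid)
open import Algebra.Properties.CommutativeSemigroup using (interchange)
open import Data.Bool using (true; false; if_then_else_; T; _∧_)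
open import Data.Fin as Fin using (Fin; toℕ)
import Data.Fin.Properties as FinP
import Data.Integer as ℤ
import Data.Integer.Properties as ℤP
open import Data.List using (List; []; _∷_)
open import Data.List.Relation.Unary.All using (All; []; _∷_)
open import Data.Nat as ℕ using (ℕ; zero; suc; _≤_; _<_; z≤n; s≤s; _∸_; _≡ᵇ_; _<ᵇ_; _≟_)
import Data.Nat.Coprimality as Coprime
import Data.Nat.Properties as ℕP
open import Data.Product using (_×_; _,_; proj₂)
open import Data.Rational as ℚ using (ℚ; 0ℚ; 1ℚ; mkℚ; 1/_)
import Data.Rational.Properties as ℚP
open import Data.Rational.Solver using (module +-*-Solver)
open import Data.Sum as Sum using (_⊎_; inj₁; inj₂)
open import Function using (_∘_)
open import Relation.Binary using (Tri; tri<; tri≈; tri>)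
open import Relation.Binary.PropositionalEquality
open import Relation.Nullary using (¬_; yes; no)
open import Relation.Nullary.Negation using (contradiction)
open ≡-Reasoning

T⇒≡true : ∀ {b} → T b → b ≡ true
T⇒≡true {true} _ = refl

¬T⇒≡false : ∀ {b} → ¬ T b → b ≡ false
¬T⇒≡false {true} ¬t = contradiction _ ¬t
¬T⇒≡false {false} _ = refl

≡ᵇ-refl : ∀ n → (n ≡ᵇ n) ≡ true
≡ᵇ-refl n = T⇒≡true (ℕP.≡⇒≡ᵇ n n refl)

≢⇒≡ᵇ≡false : ∀ {m n} → m ≢ n → (m ≡ᵇ n) ≡ false
≢⇒≡ᵇ≡false {m} {n} m≢n = ¬T⇒≡false (m≢n ∘ ℕP.≡ᵇ⇒≡ m n)

if-true : ∀ {A : Set} {b} {x y : A} → b ≡ true → (if b then x else y) ≡ x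
if-true refl = refl

if-false : ∀ {A : Set} {b} {x y : A} → b ≡ false → (if b then x else y) ≡ y
if-false refl = refl

≤1+n-split : ∀ {a n} → a ≤ suc n → a ≤ n ⊎ a ≡ suc n
≤1+n-split a≤1+n = Sum.map₁ ℕP.≤-pred (ℕP.m≤n⇒m<n∨m≡n a≤1+n)

n≢1+n : ∀ n → n ≢ suc n
n≢1+n n = ℕP.<⇒≢ (ℕP.n<1+n n)

n≢2+n : ∀ n → n ≢ suc (suc n)
n≢2+n n = ℕP.<⇒≢ (ℕP.m<n⇒m<1+n (ℕP.n<1+n n))

2[k+r]+1∸2k : ∀ k r → 2 ℕ.* (k ℕ.+ r) ℕ.+ 1 ∸ 2 ℕ.* k ≡ suc (2 ℕ.* r)
2[k+r]+1∸2k k r = begin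
  2 ℕ.* (k ℕ.+ r) ℕ.+ 1 ∸ 2 ℕ.* k        ≡⟨ cong (λ x → x ℕ.+ 1 ∸ 2 ℕ.* k) (ℕP.*-distribˡ-+ 2 k r) ⟩
  2 ℕ.* k ℕ.+ 2 ℕ.* r ℕ.+ 1 ∸ 2 ℕ.* k    ≡⟨ cong (_∸ 2 ℕ.* k) (ℕP.+-assoc (2 ℕ.* k) (2 ℕ.* r) 1) ⟩
  2 ℕ.* k ℕ.+ (2 ℕ.* r ℕ.+ 1) ∸ 2 ℕ.* k  ≡⟨ ℕP.m+n∸m≡n (2 ℕ.* k) (2 ℕ.* r ℕ.+ 1) ⟩
  2 ℕ.* r ℕ.+ 1                            ≡⟨ ℕP.+-comm (2 ℕ.* r) 1 ⟩
  suc (2 ℕ.* r)                            ∎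

L≡F+F : ∀ n → L (suc n) ≡ F n ℕ.+ F (suc (suc n))
L≡F+F zero = refl
L≡F+F (suc zero) = refl
L≡F+F (suc (suc n)) = begin
  L (suc (suc n)) ℕ.+ L (suc n)
    ≡⟨ cong₂ ℕ._+_ (L≡F+F (suc n)) (L≡F+F n) ⟩
  (F (suc n) ℕ.+ F (3 ℕ.+ n)) ℕ.+ (F n ℕ.+ F (2 ℕ.+ n))
    ≡⟨ interchange ℕP.+-commutativeSemigroup (F (suc n)) (F (3 ℕ.+ n)) (F n) (F (2 ℕ.+ n)) ⟩
  (F (suc n) ℕ.+ F n) ℕ.+ (F (3 ℕ.+ n) ℕ.+ F (2 ℕ.+ n)) ∎

-- Id i j is definitionally δ (toℕ i) (toℕ j).
δ : ℕ → ℕ → ℚ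
δ x t = if x ≡ᵇ t then 1ℚ else 0ℚ

δ-refl : ∀ x → δ x x ≡ 1ℚ
δ-refl x rewrite ≡ᵇ-refl x = refl

δ-≢ : ∀ {x t} → x ≢ t → δ x t ≡ 0ℚ
δ-≢ x≢t rewrite ≢⇒≡ᵇ≡false x≢t = refl

-- ℚ arithmetic is opened only inside this module, so that proposition1 can be stated with _+_ and _*_ on ℕ.
module _ where

  open import Data.Rational using (_+_; _*_; _-_; -_)
  open +-*-Solver using (solve; _:+_; _:*_; _:-_; _:=_; con)

  qN≡mkℚ : ∀ n → qN n ≡ mkℚ (ℤ.+ n) 0 (Coprime.sym (Coprime.1-coprimeTo n))
  qN≡mkℚ n = ℚP.normalize-coprime (Coprime.sym (Coprime.1-coprimeTo n))

  qN-homo-+ : ∀ m n → qN (m ℕ.+ n) ≡ qN m + qN n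
  qN-homo-+ m n = trans
    (cong (ℚ._/ 1) (sym (cong₂ ℤ._+_ (ℤP.*-identityʳ (ℤ.+ m)) (ℤP.*-identityʳ (ℤ.+ n)))))
    (cong₂ _+_ (sym (qN≡mkℚ m)) (sym (qN≡mkℚ n)))

  qN-homo-* : ∀ m n → qN (m ℕ.* n) ≡ qN m * qN n
  qN-homo-* m n = trans (cong (ℚ._/ 1) (ℤP.pos-* m n)) (cong₂ _*_ (sym (qN≡mkℚ m)) (sym (qN≡mkℚ n)))

  1/n*n≡1 : ∀ n .{{_ : ℕ.NonZero n}} → ((ℤ.+ 1) ℚ./ n) * qN n ≡ 1ℚ
  1/n*n≡1 (suc n) = trans
    (cong₂ _*_ (ℚP.normalize-coprime {1} {n} (Coprime.1-coprimeTo (suc n))) (qN≡mkℚ (suc n)))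
    (ℚP.*-inverseˡ (mkℚ (ℤ.+ suc n) 0 (Coprime.sym (Coprime.1-coprimeTo (suc n)))))

  *-cancelʳ-≡ : ∀ {x y} z .{{_ : ℚ.NonZero z}} → x * z ≡ y * z → x ≡ y
  *-cancelʳ-≡ {x} {y} z eq = trans (sym (x*z/z≡x x)) (trans (cong (_* 1/ z) eq) (x*z/z≡x y))
    where
    x*z/z≡x : ∀ x → x * z * 1/ z ≡ x
    x*z/z≡x x = trans (ℚP.*-assoc x z (1/ z)) (trans (cong (x *_) (ℚP.*-inverseʳ z)) (ℚP.*-identityʳ x))

  ∑< : ℕ → (ℕ → ℚ) → ℚ
  ∑< zero g = 0ℚ
  ∑< (suc n) g = g 0 + ∑< n (λ k → g (suc k))

  ∑-toℕ : ∀ n (g : ℕ → ℚ) → ∑ (λ (k : Fin n) → g (toℕ k)) ≡ ∑< n g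
  ∑-toℕ zero g = refl
  ∑-toℕ (suc n) g = cong (g 0 +_) (∑-toℕ n (g ∘ suc))

  ∑<-cong : ∀ n {f g : ℕ → ℚ} → (∀ k → k < n → f k ≡ g k) → ∑< n f ≡ ∑< n g
  ∑<-cong zero f≡g = refl
  ∑<-cong (suc n) f≡g = cong₂ _+_ (f≡g 0 (s≤s z≤n)) (∑<-cong n (λ k k<n → f≡g (suc k) (s≤s k<n)))

  ∑<-0 : ∀ n → ∑< n (λ _ → 0ℚ) ≡ 0ℚ
  ∑<-0 zero = refl
  ∑<-0 (suc n) = trans (ℚP.+-identityˡ _) (∑<-0 n)

  ∑<-distrib-+ : ∀ n (f g : ℕ → ℚ) → ∑< n (λ k → f k + g k) ≡ ∑< n f + ∑< n g
  ∑<-distrib-+ zero f g = refl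
  ∑<-distrib-+ (suc n) f g = begin
    f 0 + g 0 + ∑< n (λ k → f (suc k) + g (suc k))
      ≡⟨ cong (f 0 + g 0 +_) (∑<-distrib-+ n (f ∘ suc) (g ∘ suc)) ⟩
    f 0 + g 0 + (∑< n (f ∘ suc) + ∑< n (g ∘ suc))
      ≡⟨ interchange (CommutativeMonoid.commutativeSemigroup ℚP.+-0-commutativeMonoid)
           (f 0) (g 0) (∑< n (f ∘ suc)) (∑< n (g ∘ suc)) ⟩
    f 0 + ∑< n (f ∘ suc) + (g 0 + ∑< n (g ∘ suc)) ∎

  *-distribˡ-∑< : ∀ n x (f : ℕ → ℚ) → x * ∑< n f ≡ ∑< n (λ k → x * f k)
  *-distribˡ-∑< zero x f = ℚP.*-zeroʳ x
  *-distribˡ-∑< (suc n) x f =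
    trans (ℚP.*-distribˡ-+ x (f 0) _) (cong (x * f 0 +_) (*-distribˡ-∑< n x (f ∘ suc)))

  ∑<-init-last : ∀ n (g : ℕ → ℚ) → ∑< (suc n) g ≡ ∑< n g + g n
  ∑<-init-last zero g = trans (ℚP.+-identityʳ (g 0)) (sym (ℚP.+-identityˡ (g 0)))
  ∑<-init-last (suc n) g = trans (cong (g 0 +_) (∑<-init-last n (g ∘ suc))) (sym (ℚP.+-assoc (g 0) _ _))

  ∑<-δ : ∀ n t (g : ℕ → ℚ) → t < n → ∑< n (λ k → δ k t * g k) ≡ g t
  ∑<-δ (suc n) zero g _ = begin
    1ℚ * g 0 + ∑< n (λ k → 0ℚ * g (suc k))
      ≡⟨ cong₂ _+_ (ℚP.*-identityˡ (g 0)) (∑<-cong n (λ k _ → ℚP.*-zeroˡ (g (suc k)))) ⟩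
    g 0 + ∑< n (λ _ → 0ℚ)
      ≡⟨ trans (cong (g 0 +_) (∑<-0 n)) (ℚP.+-identityʳ (g 0)) ⟩
    g 0 ∎
  ∑<-δ (suc n) (suc t) g (s≤s t<n) = begin
    0ℚ * g 0 + ∑< n (λ k → δ k t * g (suc k))  ≡⟨ cong (_+ ∑< n (λ k → δ k t * g (suc k))) (ℚP.*-zeroˡ (g 0)) ⟩
    0ℚ + ∑< n (λ k → δ k t * g (suc k))        ≡⟨ ℚP.+-identityˡ _ ⟩
    ∑< n (λ k → δ k t * g (suc k))             ≡⟨ ∑<-δ n t (g ∘ suc) t<n ⟩
    g (suc t)                                  ∎

  ∑<-δ-suc : ∀ n t {g : ℕ → ℚ} → g 0 ≡ 0ℚ → t ≤ n → ∑< n (λ k → δ (suc k) t * g (suc k)) ≡ g t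
  ∑<-δ-suc n zero {g} g0≡0 _ = trans (∑<-cong n (λ k _ → ℚP.*-zeroˡ (g (suc k)))) (trans (∑<-0 n) (sym g0≡0))
  ∑<-δ-suc n (suc t) {g} _ t<n = ∑<-δ n t (g ∘ suc) t<n

  sparse : List (ℚ × ℕ) → ℕ → ℚ
  sparse [] x = 0ℚ
  sparse ((w , t) ∷ ws) x = w * δ x t + sparse ws x

  sparse-dot : List (ℚ × ℕ) → (ℕ → ℚ) → ℚ
  sparse-dot [] g = 0ℚ
  sparse-dot ((w , t) ∷ ws) g = w * g t + sparse-dot ws g

  ∑<-sparse : ∀ n ws {g : ℕ → ℚ} → g 0 ≡ 0ℚ → All (λ wt → proj₂ wt ≤ n) ws →
    ∑< n (λ k → sparse ws (suc k) * g (suc k)) ≡ sparse-dot ws g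
  ∑<-sparse n [] {g} _ [] = trans (∑<-cong n (λ k _ → ℚP.*-zeroˡ (g (suc k)))) (∑<-0 n)
  ∑<-sparse n ((w , t) ∷ ws) {g} g0≡0 (t≤n ∷ ws≤n) = begin
    ∑< n (λ k → (w * δ (suc k) t + sparse ws (suc k)) * g (suc k))
      ≡⟨ ∑<-cong n (λ k _ → distrib w (δ (suc k) t) (sparse ws (suc k)) (g (suc k))) ⟩
    ∑< n (λ k → w * (δ (suc k) t * g (suc k)) + sparse ws (suc k) * g (suc k))
      ≡⟨ ∑<-distrib-+ n _ _ ⟩
    ∑< n (λ k → w * (δ (suc k) t * g (suc k))) + ∑< n (λ k → sparse ws (suc k) * g (suc k))
      ≡⟨ cong₂ _+_ (sym (*-distribˡ-∑< n w _)) (∑<-sparse n ws g0≡0 ws≤n) ⟩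
    w * ∑< n (λ k → δ (suc k) t * g (suc k)) + sparse-dot ws g
      ≡⟨ cong (λ s → w * s + sparse-dot ws g) (∑<-δ-suc n t {g} g0≡0 t≤n) ⟩
    w * g t + sparse-dot ws g ∎
    where
    distrib : ∀ w d s c → (w * d + s) * c ≡ w * (d * c) + s * c
    distrib = solve 4 (λ w d s c → (w :* d :+ s) :* c := w :* (d :* c) :+ s :* c) refl

  ∑-cong : ∀ {n} {f g : Fin n → ℚ} → (∀ k → f k ≡ g k) → ∑ f ≡ ∑ g
  ∑-cong {zero} f≡g = refl
  ∑-cong {suc n} f≡g = cong₂ _+_ (f≡g Fin.zero) (∑-cong (f≡g ∘ Fin.suc))

  ∑-distribʳ : ∀ {n} (f : Fin n → ℚ) x → ∑ f * x ≡ ∑ (λ k → f k * x)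
  ∑-distribʳ {zero} f x = ℚP.*-zeroˡ x
  ∑-distribʳ {suc n} f x =
    trans (ℚP.*-distribʳ-+ x (f Fin.zero) _) (cong (f Fin.zero * x +_) (∑-distribʳ (f ∘ Fin.suc) x))

  module _ {n : ℕ} (w : Fin n → ℚ) where

    ScaledSymmetric : Matrix n → Set
    ScaledSymmetric A = ∀ i j → A i j * w j ≡ A j i * w i

    Id-scaledSymmetric : ScaledSymmetric Id
    Id-scaledSymmetric i j with i Fin.≟ j
    ... | yes refl = refl
    ... | no i≢j = trans (Id≡0 i≢j (w j)) (sym (Id≡0 (i≢j ∘ sym) (w i)))
      where
      Id≡0 : ∀ {i j} → i ≢ j → ∀ x → Id i j * x ≡ 0ℚ
      Id≡0 i≢j x = trans (cong (_* x) (δ-≢ (i≢j ∘ FinP.toℕ-injective))) (ℚP.*-zeroˡ x)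

    ⊗-scaledTranspose : ∀ {A B} → ScaledSymmetric A → ScaledSymmetric B →
      ∀ i j → (B ⊗ A) i j * w j ≡ (A ⊗ B) j i * w i
    ⊗-scaledTranspose {A} {B} symA symB i j = begin
      ∑ (λ k → B i k * A k j) * w j  ≡⟨ ∑-distribʳ (λ k → B i k * A k j) (w j) ⟩
      ∑ (λ k → B i k * A k j * w j)  ≡⟨ ∑-cong swap ⟩
      ∑ (λ k → A j k * B k i * w i)  ≡⟨ sym (∑-distribʳ (λ k → A j k * B k i) (w i)) ⟩
      ∑ (λ k → A j k * B k i) * w i  ∎
      where
      rearrange : ∀ b a x → b * (a * x) ≡ a * (b * x)
      rearrange = solve 3 (λ b a x → b :* (a :* x) := a :* (b :* x)) refl
      swap : ∀ k → B i k * A k j * w j ≡ A j k * B k i * w i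
      swap k = begin
        B i k * A k j * w j    ≡⟨ ℚP.*-assoc (B i k) _ _ ⟩
        B i k * (A k j * w j)  ≡⟨ cong (B i k *_) (symA k j) ⟩
        B i k * (A j k * w k)  ≡⟨ rearrange (B i k) (A j k) (w k) ⟩
        A j k * (B i k * w k)  ≡⟨ cong (A j k *_) (symB i k) ⟩
        A j k * (B k i * w i)  ≡⟨ sym (ℚP.*-assoc (A j k) _ _) ⟩
        A j k * B k i * w i    ∎

    ⊗-inverse-swap : (∀ i → ℚ.NonZero (w i)) → ∀ {A B} → ScaledSymmetric A → ScaledSymmetric B →
      (∀ i j → (A ⊗ B) i j ≡ Id i j) → ∀ i j → (B ⊗ A) i j ≡ Id i j
    ⊗-inverse-swap w≢0 {A} {B} symA symB AB≡Id i j = *-cancelʳ-≡ (w j) {{w≢0 j}} (begin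
      (B ⊗ A) i j * w j  ≡⟨ ⊗-scaledTranspose {A} {B} symA symB i j ⟩
      (A ⊗ B) j i * w i  ≡⟨ cong (_* w i) (AB≡Id j i) ⟩
      Id j i * w i       ≡⟨ Id-scaledSymmetric j i ⟩
      Id i j * w j       ∎)

  -- The stencil of the rows 1 … m-1 of H (see applyH-rowA).
  ∇ : (ℕ → ℚ) → ℕ → ℚ
  ∇ y q = qN 3 * y (suc q) - y q - y (suc (suc q))

  ∇≡0⇒ : ∀ {y q} → ∇ y q ≡ 0ℚ → y q ≡ qN 3 * y (suc q) - y (suc (suc q))
  ∇≡0⇒ {y} {q} ∇y≡0 = begin
    y q
      ≡⟨ solve 3 (λ a b c → a := con (qN 3) :* b :- c :- (con (qN 3) :* b :- a :- c)) refl
           (y q) (y (suc q)) (y (suc (suc q))) ⟩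
    qN 3 * y (suc q) - y (suc (suc q)) - ∇ y q
      ≡⟨ cong (λ x → qN 3 * y (suc q) - y (suc (suc q)) - x) ∇y≡0 ⟩
    qN 3 * y (suc q) - y (suc (suc q)) - 0ℚ
      ≡⟨ solve 2 (λ b c → con (qN 3) :* b :- c :- con 0ℚ := con (qN 3) :* b :- c) refl
           (y (suc q)) (y (suc (suc q))) ⟩
    qN 3 * y (suc q) - y (suc (suc q)) ∎

  a+c≡3b⇒∇≡0 : ∀ a b c → a + c ≡ qN 3 * b → qN 3 * b - a - c ≡ 0ℚ
  a+c≡3b⇒∇≡0 a b c a+c≡3b = begin
    qN 3 * b - a - c  ≡⟨ cong (λ x → x - a - c) (sym a+c≡3b) ⟩
    a + c - a - c     ≡⟨ solve 2 (λ a c → a :+ c :- a :- c := con 0ℚ) refl a c ⟩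
    0ℚ                ∎

  ∇-affine : ∀ {y u v : ℕ → ℚ} {q} α β γ → ∇ u q ≡ 0ℚ → ∇ v q ≡ 0ℚ →
    (∀ {k} → q ≤ k → k ≤ suc (suc q) → y k ≡ α + β * u k + γ * v k) → ∇ y q ≡ α
  ∇-affine {y} {u} {v} {q} α β γ ∇u≡0 ∇v≡0 y≡ = begin
    qN 3 * y (suc q) - y q - y (suc (suc q))
      ≡⟨ cong₂ (λ a b → qN 3 * a - y q - b) (y≡ (ℕP.n≤1+n q) (ℕP.n≤1+n (suc q)))
               (y≡ (ℕP.m≤n⇒m≤1+n (ℕP.n≤1+n q)) ℕP.≤-refl) ⟩
    qN 3 * (α + β * u₁ + γ * v₁) - y q - (α + β * u₂ + γ * v₂)
      ≡⟨ cong (λ a → qN 3 * (α + β * u₁ + γ * v₁) - a - (α + β * u₂ + γ * v₂))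
              (y≡ ℕP.≤-refl (ℕP.m≤n⇒m≤1+n (ℕP.n≤1+n q))) ⟩
    qN 3 * (α + β * u₁ + γ * v₁) - (α + β * u₀ + γ * v₀) - (α + β * u₂ + γ * v₂)
      ≡⟨ solve 9 (λ α β γ u₀ u₁ u₂ v₀ v₁ v₂ →
           con (qN 3) :* (α :+ β :* u₁ :+ γ :* v₁) :- (α :+ β :* u₀ :+ γ :* v₀) :- (α :+ β :* u₂ :+ γ :* v₂)
           := α :+ β :* (con (qN 3) :* u₁ :- u₀ :- u₂) :+ γ :* (con (qN 3) :* v₁ :- v₀ :- v₂))
           refl α β γ u₀ u₁ u₂ v₀ v₁ v₂ ⟩
    α + β * ∇ u q + γ * ∇ v q
      ≡⟨ cong₂ (λ a b → α + β * a + γ * b) ∇u≡0 ∇v≡0 ⟩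
    α + β * 0ℚ + γ * 0ℚ
      ≡⟨ solve 3 (λ α β γ → α :+ β :* con 0ℚ :+ γ :* con 0ℚ := α) refl α β γ ⟩
    α ∎
    where
    u₀ u₁ u₂ v₀ v₁ v₂ : ℚ
    u₀ = u q
    u₁ = u (suc q)
    u₂ = u (suc (suc q))
    v₀ = v q
    v₁ = v (suc q)
    v₂ = v (suc (suc q))

  IsGibonacci : (ℕ → ℚ) → Set
  IsGibonacci s = ∀ n → s (suc (suc n)) ≡ s (suc n) + s n

  F-gibonacci : IsGibonacci (qN ∘ F)
  F-gibonacci n = qN-homo-+ (F (suc n)) (F n)

  L-gibonacci : IsGibonacci (qN ∘ L)
  L-gibonacci n = qN-homo-+ (L (suc n)) (L n)

  gibonacci-skip : ∀ {s} → IsGibonacci s → ∀ n → s n + s (4 ℕ.+ n) ≡ qN 3 * s (2 ℕ.+ n)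
  gibonacci-skip s-rec n = skip (s-rec n) (s-rec (1 ℕ.+ n)) (s-rec (2 ℕ.+ n))
    where
    skip : ∀ {a b c d e} → c ≡ a + b → d ≡ c + a → e ≡ d + c → b + e ≡ qN 3 * c
    skip {a} {b} refl refl refl =
      solve 2 (λ a b → b :+ ((a :+ b :+ a) :+ (a :+ b)) := con (qN 3) :* (a :+ b)) refl a b

  gibonacci-3 : ∀ {s} → IsGibonacci s → ∀ n → s (3 ℕ.+ n) ≡ qN 2 * s (2 ℕ.+ n) - s n
  gibonacci-3 s-rec n = three (s-rec n) (s-rec (1 ℕ.+ n))
    where
    three : ∀ {a b c d} → c ≡ a + b → d ≡ c + a → d ≡ qN 2 * c - b
    three {a} {b} refl refl = solve 2 (λ a b → a :+ b :+ a := con (qN 2) :* (a :+ b) :- b) refl a b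

  module Entries (m N : ℕ) where

    H-diag : ∀ {a} → a ≢ m → a ≢ suc m → Hentry m N a a ≡ qN 3
    H-diag {a} a≢m a≢1+m rewrite ≡ᵇ-refl a | ≢⇒≡ᵇ≡false a≢m | ≢⇒≡ᵇ≡false a≢1+m = refl

    H-diag-m : Hentry m N m m ≡ qN 2
    H-diag-m rewrite ≡ᵇ-refl m = refl

    H-corner : Hentry m N (suc m) (suc m) ≡ qN N
    H-corner rewrite ≡ᵇ-refl m | ≢⇒≡ᵇ≡false (ℕP.1+n≢n {m}) = refl

    H-super : ∀ {a} → a ≢ suc m → Hentry m N a (suc a) ≡ - 1ℚ
    H-super {a} a≢1+m rewrite ≡ᵇ-refl a | ≢⇒≡ᵇ≡false (n≢1+n a) | ≢⇒≡ᵇ≡false a≢1+m = refl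

    H-sub : ∀ {b} → b ≢ m → Hentry m N (suc b) b ≡ - 1ℚ
    H-sub {b} b≢m rewrite ≡ᵇ-refl b | ≢⇒≡ᵇ≡false (ℕP.1+n≢n {b}) | ≢⇒≡ᵇ≡false (n≢2+n b ∘ sym)
      | ≢⇒≡ᵇ≡false b≢m = refl

    H-lastcol : ∀ {a} → 1 ≤ a → a ≤ m → Hentry m N a (suc m) ≡ - 1ℚ
    H-lastcol {a} 1≤a a≤m with ℕP.m≤n⇒m<n∨m≡n a≤m
    ... | inj₂ refl = H-super (n≢1+n a)
    ... | inj₁ a<m rewrite ≢⇒≡ᵇ≡false (ℕP.<⇒≢ (ℕP.m<n⇒m<1+n a<m)) | ≢⇒≡ᵇ≡false (ℕP.<⇒≢ a<m)
      | ≢⇒≡ᵇ≡false (ℕP.>⇒≢ (ℕP.m<n⇒m<1+n (ℕP.m<n⇒m<1+n a<m))) | ≡ᵇ-refl m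
      | T⇒≡true (ℕP.≤⇒≤ᵇ 1≤a) | T⇒≡true (ℕP.≤⇒≤ᵇ a≤m) = refl

    H-lastrow : ∀ {b} → 1 ≤ b → b ≤ m → Hentry m N (suc m) b ≡ - qN 2
    H-lastrow {b} 1≤b b≤m with ℕP.m≤n⇒m<n∨m≡n b≤m
    ... | inj₂ refl rewrite ≡ᵇ-refl b | ≢⇒≡ᵇ≡false (ℕP.1+n≢n {b}) | ≢⇒≡ᵇ≡false (n≢2+n b ∘ sym)
      | ≢⇒≡ᵇ≡false (n≢1+n b) | T⇒≡true (ℕP.≤⇒≤ᵇ 1≤b) | T⇒≡true (ℕP.≤⇒≤ᵇ (ℕP.≤-refl {b})) = refl
    ... | inj₁ b<m rewrite ≡ᵇ-refl m | ≢⇒≡ᵇ≡false (ℕP.>⇒≢ (ℕP.m<n⇒m<1+n b<m))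
      | ≢⇒≡ᵇ≡false (ℕP.>⇒≢ (ℕP.m<n⇒m<1+n (ℕP.m<n⇒m<1+n b<m))) | ≢⇒≡ᵇ≡false (ℕP.<⇒≢ b<m)
      | ≢⇒≡ᵇ≡false (ℕP.<⇒≢ (ℕP.m<n⇒m<1+n b<m)) | T⇒≡true (ℕP.≤⇒≤ᵇ 1≤b) | T⇒≡true (ℕP.≤⇒≤ᵇ b≤m) = refl

    H-far : ∀ {a b} → a ≢ b → suc a ≢ b → suc b ≢ a → a ≢ suc m → b ≢ suc m → Hentry m N a b ≡ 0ℚ
    H-far a≢b 1+a≢b 1+b≢a a≢1+m b≢1+m rewrite ≢⇒≡ᵇ≡false a≢b | ≢⇒≡ᵇ≡false 1+a≢b | ≢⇒≡ᵇ≡false 1+b≢a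
      | ≢⇒≡ᵇ≡false a≢1+m | ≢⇒≡ᵇ≡false b≢1+m = refl

    H-symmetric : ∀ {a b} → a ≤ m → b ≤ m → Hentry m N a b ≡ Hentry m N b a
    H-symmetric {a} {b} a≤m b≤m with a ≟ b
    ... | yes refl = refl
    ... | no a≢b with suc a ≟ b
    ... | yes refl = trans (H-super (ℕP.<⇒≢ (s≤s a≤m))) (sym (H-sub (ℕP.<⇒≢ b≤m)))
    ... | no 1+a≢b with suc b ≟ a
    ... | yes refl = trans (H-sub (ℕP.<⇒≢ a≤m)) (sym (H-super (ℕP.<⇒≢ (s≤s b≤m))))
    ... | no 1+b≢a = trans (H-far a≢b 1+a≢b 1+b≢a (ℕP.<⇒≢ (s≤s a≤m)) (ℕP.<⇒≢ (s≤s b≤m)))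
      (sym (H-far (a≢b ∘ sym) 1+b≢a 1+a≢b (ℕP.<⇒≢ (s≤s b≤m)) (ℕP.<⇒≢ (s≤s a≤m))))

    w : ℕ → ℚ
    w a = if a ≡ᵇ suc m then qN 2 else 1ℚ

    w-nonZero : ∀ a → ℚ.NonZero (w a)
    w-nonZero a with a ≡ᵇ suc m
    ... | true = _
    ... | false = _

    w-inner : ∀ {a} → a ≤ m → w a ≡ 1ℚ
    w-inner a≤m rewrite ≢⇒≡ᵇ≡false (ℕP.<⇒≢ (s≤s a≤m)) = refl

    w-last : w (suc m) ≡ qN 2
    w-last rewrite ≡ᵇ-refl m = refl

    H-scaledSymmetric : ∀ {a b} → 1 ≤ a → a ≤ suc m → 1 ≤ b → b ≤ suc m →
      Hentry m N a b * w b ≡ Hentry m N b a * w a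
    H-scaledSymmetric 1≤a a≤1+m 1≤b b≤1+m = by-cases 1≤a 1≤b (≤1+n-split a≤1+m) (≤1+n-split b≤1+m)
      where
      by-cases : ∀ {a b} → 1 ≤ a → 1 ≤ b → a ≤ m ⊎ a ≡ suc m → b ≤ m ⊎ b ≡ suc m →
        Hentry m N a b * w b ≡ Hentry m N b a * w a
      by-cases _ _ (inj₁ a≤m) (inj₁ b≤m) =
        cong₂ _*_ (H-symmetric a≤m b≤m) (trans (w-inner b≤m) (sym (w-inner a≤m)))
      by-cases 1≤a _ (inj₁ a≤m) (inj₂ refl) =
        trans (cong₂ _*_ (H-lastcol 1≤a a≤m) w-last) (sym (cong₂ _*_ (H-lastrow 1≤a a≤m) (w-inner a≤m)))
      by-cases _ 1≤b (inj₂ refl) (inj₁ b≤m) =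
        trans (cong₂ _*_ (H-lastrow 1≤b b≤m) (w-inner b≤m)) (sym (cong₂ _*_ (H-lastcol 1≤b b≤m) w-last))
      by-cases _ _ (inj₂ refl) (inj₂ refl) = refl

    φ : ℕ → ℚ
    φ k = qN (F (N ∸ 2 ℕ.* k))

    Λ : ℕ → ℚ
    Λ k = qN (L (2 ℕ.* k))

    G : ℕ → ℕ → ℚ
    G a b = qN 2 * (qN (F N) - φ a) + φ b * (Λ a - qN 2)

    private
      ≤⇒≡ᵇ1+≡false : ∀ {a} → a ≤ m → (a ≡ᵇ suc m) ≡ false
      ≤⇒≡ᵇ1+≡false a≤m = ≢⇒≡ᵇ≡false (ℕP.<⇒≢ (s≤s a≤m))

      Centry-inner : ∀ {a b x} → a ≤ m → b ≤ m → (if a <ᵇ b then G a b else G b a) ≡ x → Centry m N a b ≡ x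
      Centry-inner {b = b} a≤m b≤m eq = trans (if-false (cong (_∧ (b ≡ᵇ suc m)) (≤⇒≡ᵇ1+≡false a≤m)))
        (trans (if-false (≤⇒≡ᵇ1+≡false a≤m)) (trans (if-false (≤⇒≡ᵇ1+≡false b≤m)) eq))

    Centry-≤ : ∀ {a b} → a ≤ b → b ≤ m → Centry m N a b ≡ G a b
    Centry-≤ a≤b b≤m = by-cases b≤m (ℕP.m≤n⇒m<n∨m≡n a≤b)
      where
      by-cases : ∀ {a b} → b ≤ m → a < b ⊎ a ≡ b → Centry m N a b ≡ G a b
      by-cases b≤m (inj₁ a<b) =
        Centry-inner (ℕP.<⇒≤ (ℕP.<-≤-trans a<b b≤m)) b≤m (if-true (T⇒≡true (ℕP.<⇒<ᵇ a<b)))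
      by-cases {a} b≤m (inj₂ refl) = Centry-inner b≤m b≤m (if-false (¬T⇒≡false (ℕP.n≮n a ∘ ℕP.<ᵇ⇒< a a)))

    Centry-≥ : ∀ {a b} → b ≤ a → a ≤ m → Centry m N a b ≡ G b a
    Centry-≥ {a} {b} b≤a a≤m =
      Centry-inner a≤m (ℕP.≤-trans b≤a a≤m) (if-false (¬T⇒≡false (ℕP.≤⇒≯ b≤a ∘ ℕP.<ᵇ⇒< a b)))

    Centry-lastcol : ∀ {a} → a ≤ m → Centry m N a (suc m) ≡ qN (F N) - φ a
    Centry-lastcol a≤m = trans (if-false (cong (_∧ (m ≡ᵇ m)) (≤⇒≡ᵇ1+≡false a≤m)))
      (trans (if-false (≤⇒≡ᵇ1+≡false a≤m)) (if-true (≡ᵇ-refl m)))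

    Centry-lastrow : ∀ {b} → b ≤ m → Centry m N (suc m) b ≡ qN 2 * (qN (F N) - φ b)
    Centry-lastrow b≤m = trans (if-false (cong₂ _∧_ (≡ᵇ-refl m) (≤⇒≡ᵇ1+≡false b≤m))) (if-true (≡ᵇ-refl m))

    Centry-corner : Centry m N (suc m) (suc m) ≡ qN (F N)
    Centry-corner = if-true (cong₂ _∧_ (≡ᵇ-refl m) (≡ᵇ-refl m))

    C-symmetric : ∀ {a b} → a ≤ m → b ≤ m → Centry m N a b ≡ Centry m N b a
    C-symmetric a≤m b≤m = by-cases a≤m b≤m (ℕP.≤-total _ _)
      where
      by-cases : ∀ {a b} → a ≤ m → b ≤ m → a ≤ b ⊎ b ≤ a → Centry m N a b ≡ Centry m N b a
      by-cases _ b≤m (inj₁ a≤b) = trans (Centry-≤ a≤b b≤m) (sym (Centry-≥ a≤b b≤m))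
      by-cases a≤m _ (inj₂ b≤a) = trans (Centry-≥ b≤a a≤m) (sym (Centry-≤ b≤a a≤m))

    C-scaledSymmetric : ∀ {a b} → a ≤ suc m → b ≤ suc m → Centry m N a b * w b ≡ Centry m N b a * w a
    C-scaledSymmetric a≤1+m b≤1+m = by-cases (≤1+n-split a≤1+m) (≤1+n-split b≤1+m)
      where
      last-scaled : ∀ {a} → a ≤ m → Centry m N a (suc m) * w (suc m) ≡ Centry m N (suc m) a * w a
      last-scaled {a} a≤m = begin
        Centry m N a (suc m) * w (suc m)  ≡⟨ cong₂ _*_ (Centry-lastcol a≤m) w-last ⟩
        (qN (F N) - φ a) * qN 2
          ≡⟨ solve 1 (λ y → y :* con (qN 2) := con (qN 2) :* y :* con 1ℚ) refl (qN (F N) - φ a) ⟩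
        qN 2 * (qN (F N) - φ a) * 1ℚ      ≡⟨ sym (cong₂ _*_ (Centry-lastrow a≤m) (w-inner a≤m)) ⟩
        Centry m N (suc m) a * w a        ∎
      by-cases : ∀ {a b} → a ≤ m ⊎ a ≡ suc m → b ≤ m ⊎ b ≡ suc m →
        Centry m N a b * w b ≡ Centry m N b a * w a
      by-cases (inj₁ a≤m) (inj₁ b≤m) =
        cong₂ _*_ (C-symmetric a≤m b≤m) (trans (w-inner b≤m) (sym (w-inner a≤m)))
      by-cases (inj₁ a≤m) (inj₂ refl) = last-scaled a≤m
      by-cases (inj₂ refl) (inj₁ b≤m) = sym (last-scaled b≤m)
      by-cases (inj₂ refl) (inj₂ refl) = refl

  module Rows (p N : ℕ) where

    m : ℕ
    m = suc p

    open Entries m N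

    stencilA : ℕ → List (ℚ × ℕ)
    stencilA q = (- 1ℚ , q) ∷ (qN 3 , suc q) ∷ (- 1ℚ , suc (suc q)) ∷ (- 1ℚ , suc m) ∷ []

    stencilA-at : ∀ {q x d₀ d₁ d₂ d₃} →
      δ x q ≡ d₀ → δ x (suc q) ≡ d₁ → δ x (suc (suc q)) ≡ d₂ → δ x (suc m) ≡ d₃ →
      sparse (stencilA q) x ≡ - 1ℚ * d₀ + (qN 3 * d₁ + (- 1ℚ * d₂ + (- 1ℚ * d₃ + 0ℚ)))
    stencilA-at refl refl refl refl = refl

    H-rowA : ∀ {q x} → suc q < m → Hentry m N (suc q) x ≡ sparse (stencilA q) x
    H-rowA {q} {x} 1+q<m with x ≟ q
    ... | yes refl = trans (H-sub (ℕP.<⇒≢ (ℕP.<-trans (ℕP.n<1+n x) 1+q<m)))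
      (sym (stencilA-at {q} {x} (δ-refl x) (δ-≢ (n≢1+n x)) (δ-≢ (n≢2+n x))
        (δ-≢ (ℕP.<⇒≢ (ℕP.<-trans (ℕP.n<1+n x) (ℕP.m<n⇒m<1+n 1+q<m))))))
    ... | no x≢q with x ≟ suc q
    ... | yes refl = trans (H-diag (ℕP.<⇒≢ 1+q<m) (ℕP.<⇒≢ (ℕP.m<n⇒m<1+n 1+q<m)))
      (sym (stencilA-at {q} {x} (δ-≢ (ℕP.1+n≢n {q})) (δ-refl (suc q)) (δ-≢ (n≢1+n (suc q)))
        (δ-≢ (ℕP.<⇒≢ (ℕP.m<n⇒m<1+n 1+q<m)))))
    ... | no x≢1+q with x ≟ suc (suc q)
    ... | yes refl = trans (H-super (ℕP.<⇒≢ (ℕP.m<n⇒m<1+n 1+q<m)))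
      (sym (stencilA-at {q} {x} (δ-≢ (n≢2+n q ∘ sym)) (δ-≢ (ℕP.1+n≢n {suc q})) (δ-refl (suc (suc q)))
        (δ-≢ (ℕP.<⇒≢ (s≤s 1+q<m)))))
    ... | no x≢2+q with x ≟ suc m
    ... | yes refl = trans (H-lastcol (s≤s z≤n) (ℕP.<⇒≤ 1+q<m))
      (sym (stencilA-at {q} {x} (δ-≢ (ℕP.>⇒≢ (ℕP.<-trans (ℕP.n<1+n q) (ℕP.m<n⇒m<1+n 1+q<m))))
        (δ-≢ (ℕP.>⇒≢ (ℕP.m<n⇒m<1+n 1+q<m))) (δ-≢ (ℕP.>⇒≢ (s≤s 1+q<m))) (δ-refl (suc m))))
    ... | no x≢1+m =
      trans (H-far (x≢1+q ∘ sym) (x≢2+q ∘ sym) (x≢q ∘ ℕP.suc-injective) (ℕP.<⇒≢ (ℕP.m<n⇒m<1+n 1+q<m)) x≢1+m)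
        (sym (stencilA-at {q} {x} (δ-≢ x≢q) (δ-≢ x≢1+q) (δ-≢ x≢2+q) (δ-≢ x≢1+m)))

    stencilB : List (ℚ × ℕ)
    stencilB = (- 1ℚ , p) ∷ (qN 2 , m) ∷ (- 1ℚ , suc m) ∷ []

    stencilB-at : ∀ {x d₀ d₁ d₂} → δ x p ≡ d₀ → δ x m ≡ d₁ → δ x (suc m) ≡ d₂ →
      sparse stencilB x ≡ - 1ℚ * d₀ + (qN 2 * d₁ + (- 1ℚ * d₂ + 0ℚ))
    stencilB-at refl refl refl = refl

    H-rowB : ∀ {x} → Hentry m N m x ≡ sparse stencilB x
    H-rowB {x} with x ≟ p
    ... | yes refl = trans (H-sub (n≢1+n x))
      (sym (stencilB-at {x} (δ-refl x) (δ-≢ (n≢1+n x)) (δ-≢ (n≢2+n x))))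
    ... | no x≢p with x ≟ m
    ... | yes refl = trans H-diag-m (sym (stencilB-at {x} (δ-≢ (ℕP.1+n≢n {p})) (δ-refl m) (δ-≢ (n≢1+n m))))
    ... | no x≢m with x ≟ suc m
    ... | yes refl = trans (H-super (n≢1+n m))
      (sym (stencilB-at {x} (δ-≢ (n≢2+n p ∘ sym)) (δ-≢ (ℕP.1+n≢n {suc p})) (δ-refl (suc m))))
    ... | no x≢1+m = trans (H-far (x≢m ∘ sym) (x≢1+m ∘ sym) (x≢p ∘ ℕP.suc-injective) (n≢1+n m) x≢1+m)
      (sym (stencilB-at {x} (δ-≢ x≢p) (δ-≢ x≢m) (δ-≢ x≢1+m)))

    -- Entry a of H·c for a column c indexed by 1 … m+1.  The value c 0 is never read, but stencilA 0
    -- refers to it, so the row lemmas assume c 0 ≡ 0ℚ.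
    applyH : (ℕ → ℚ) → ℕ → ℚ
    applyH c a = ∑< (suc m) (λ k → Hentry m N a (suc k) * c (suc k))

    applyH-sparse : ∀ {a} ws (c : ℕ → ℚ) → c 0 ≡ 0ℚ → All (λ wt → proj₂ wt ≤ suc m) ws →
      (∀ x → Hentry m N a x ≡ sparse ws x) → applyH c a ≡ sparse-dot ws c
    applyH-sparse ws c c0≡0 ws≤1+m row =
      trans (∑<-cong (suc m) (λ k _ → cong (_* c (suc k)) (row (suc k)))) (∑<-sparse (suc m) ws c0≡0 ws≤1+m)

    applyH-rowA : ∀ {q} (c : ℕ → ℚ) → c 0 ≡ 0ℚ → suc q < m → applyH c (suc q) ≡ ∇ c q - c (suc m)
    applyH-rowA {q} c c0≡0 1+q<m =
      trans (applyH-sparse {suc q} (stencilA q) c c0≡0 bounds (λ x → H-rowA {q} {x} 1+q<m))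
        (collect (c q) (c (suc q)) (c (suc (suc q))) (c (suc m)))
      where
      bounds : All (λ wt → proj₂ wt ≤ suc m) (stencilA q)
      bounds = ℕP.<⇒≤ (ℕP.<-trans (ℕP.n<1+n q) (ℕP.m<n⇒m<1+n 1+q<m)) ∷ ℕP.<⇒≤ (ℕP.m<n⇒m<1+n 1+q<m)
             ∷ ℕP.m≤n⇒m≤1+n 1+q<m ∷ ℕP.≤-refl ∷ []
      collect : ∀ a b d e → - 1ℚ * a + (qN 3 * b + (- 1ℚ * d + (- 1ℚ * e + 0ℚ))) ≡ qN 3 * b - a - d - e
      collect = solve 4 (λ a b d e →
        con (- 1ℚ) :* a :+ (con (qN 3) :* b :+ (con (- 1ℚ) :* d :+ (con (- 1ℚ) :* e :+ con 0ℚ)))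
        := con (qN 3) :* b :- a :- d :- e) refl

    applyH-rowB : (c : ℕ → ℚ) → c 0 ≡ 0ℚ → applyH c m ≡ qN 2 * c m - c p - c (suc m)
    applyH-rowB c c0≡0 =
      trans (applyH-sparse {m} stencilB c c0≡0 bounds (λ x → H-rowB {x})) (collect (c p) (c m) (c (suc m)))
      where
      bounds : All (λ wt → proj₂ wt ≤ suc m) stencilB
      bounds = ℕP.m≤n⇒m≤1+n (ℕP.n≤1+n p) ∷ ℕP.n≤1+n m ∷ ℕP.≤-refl ∷ []
      collect : ∀ a b e → - 1ℚ * a + (qN 2 * b + (- 1ℚ * e + 0ℚ)) ≡ qN 2 * b - a - e
      collect = solve 3 (λ a b e → con (- 1ℚ) :* a :+ (con (qN 2) :* b :+ (con (- 1ℚ) :* e :+ con 0ℚ))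
                                   := con (qN 2) :* b :- a :- e) refl

    applyH-last : (c : ℕ → ℚ) → applyH c (suc m) ≡ qN N * c (suc m) - qN 2 * ∑< m (c ∘ suc)
    applyH-last c = begin
      applyH c (suc m)
        ≡⟨ ∑<-init-last m (λ k → Hentry m N (suc m) (suc k) * c (suc k)) ⟩
      ∑< m (λ k → Hentry m N (suc m) (suc k) * c (suc k)) + Hentry m N (suc m) (suc m) * c (suc m)
        ≡⟨ cong₂ _+_ (∑<-cong m (λ k k<m → cong (_* c (suc k)) (H-lastrow (s≤s z≤n) k<m)))
                     (cong (_* c (suc m)) H-corner) ⟩
      ∑< m (λ k → - qN 2 * c (suc k)) + qN N * c (suc m)
        ≡⟨ cong (_+ qN N * c (suc m)) (sym (*-distribˡ-∑< m (- qN 2) (c ∘ suc))) ⟩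
      - qN 2 * ∑< m (c ∘ suc) + qN N * c (suc m)
        ≡⟨ solve 3 (λ s x n → con (- qN 2) :* s :+ n :* x := n :* x :- con (qN 2) :* s) refl
             (∑< m (c ∘ suc)) (c (suc m)) (qN N) ⟩
      qN N * c (suc m) - qN 2 * ∑< m (c ∘ suc) ∎

    -- Row a < m of H·c is c a - c (m+1) minus the second difference of c at a, so summing the rows
    -- 1 … m telescopes.
    ∑-applyH-inner : (c : ℕ → ℚ) → c 0 ≡ 0ℚ →
      ∑< m (λ k → applyH c (suc k)) ≡ c 1 + ∑< m (c ∘ suc) - qN m * c (suc m)
    ∑-applyH-inner c c0≡0 = begin
      ∑< (suc p) Hc
        ≡⟨ ∑<-init-last p Hc ⟩
      ∑< p Hc + applyH c m
        ≡⟨ cong₂ _+_ (partial p ℕP.≤-refl) (applyH-rowB c c0≡0) ⟩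
      (c p - c m + c 1 + ∑< p cs - qN p * x) + (qN 2 * c m - c p - x)
        ≡⟨ solve 6 (λ cp cm c1 s qp x → (cp :- cm :+ c1 :+ s :- qp :* x) :+ (con (qN 2) :* cm :- cp :- x)
                                        := c1 :+ (s :+ cm) :- (con 1ℚ :+ qp) :* x) refl
             (c p) (c m) (c 1) (∑< p cs) (qN p) x ⟩
      c 1 + (∑< p cs + c m) - (1ℚ + qN p) * x
        ≡⟨ cong₂ (λ s q → c 1 + s - q * x) (sym (∑<-init-last p cs)) (sym (qN-homo-+ 1 p)) ⟩
      c 1 + ∑< m cs - qN m * x ∎
      where
      Hc cs : ℕ → ℚ
      Hc k = applyH c (suc k)
      cs k = c (suc k)
      x : ℚ
      x = c (suc m)
      partial : ∀ n → n ≤ p → ∑< n Hc ≡ c n - c (suc n) + c 1 + ∑< n cs - qN n * x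
      partial zero _ = sym (trans (cong (λ c₀ → c₀ - c 1 + c 1 + 0ℚ - 0ℚ * x) c0≡0)
        (solve 2 (λ c1 x → con 0ℚ :- c1 :+ c1 :+ con 0ℚ :- con 0ℚ :* x := con 0ℚ) refl (c 1) x))
      partial (suc n) 1+n≤p = begin
        ∑< (suc n) Hc
          ≡⟨ ∑<-init-last n Hc ⟩
        ∑< n Hc + applyH c (suc n)
          ≡⟨ cong₂ _+_ (partial n (ℕP.≤-trans (ℕP.n≤1+n n) 1+n≤p)) (applyH-rowA c c0≡0 (s≤s 1+n≤p)) ⟩
        (c n - c (suc n) + c 1 + ∑< n cs - qN n * x) + (qN 3 * c (suc n) - c n - c (suc (suc n)) - x)
          ≡⟨ solve 7 (λ c₀ c₁ c₂ c1 s qn x →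
               (c₀ :- c₁ :+ c1 :+ s :- qn :* x) :+ (con (qN 3) :* c₁ :- c₀ :- c₂ :- x)
               := c₁ :- c₂ :+ c1 :+ (s :+ c₁) :- (con 1ℚ :+ qn) :* x) refl
               (c n) (c (suc n)) (c (suc (suc n))) (c 1) (∑< n cs) (qN n) x ⟩
        c (suc n) - c (suc (suc n)) + c 1 + (∑< n cs + c (suc n)) - (1ℚ + qN n) * x
          ≡⟨ cong₂ (λ s q → c (suc n) - c (suc (suc n)) + c 1 + s - q * x)
                   (sym (∑<-init-last n cs)) (sym (qN-homo-+ 1 n)) ⟩
        c (suc n) - c (suc (suc n)) + c 1 + ∑< (suc n) cs - qN (suc n) * x ∎

    applyH-last-telescoped : N ≡ 2 ℕ.* m ℕ.+ 1 → (c : ℕ → ℚ) → c 0 ≡ 0ℚ →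
      applyH c (suc m) ≡ c (suc m) + qN 2 * c 1 - qN 2 * ∑< m (λ k → applyH c (suc k))
    applyH-last-telescoped N≡2m+1 c c0≡0 = trans (applyH-last c)
      (eliminate {qN N} {c (suc m)} {c 1} {∑< m (c ∘ suc)} {qN m}
        (trans (cong qN N≡2m+1) (trans (qN-homo-+ (2 ℕ.* m) 1) (cong (_+ 1ℚ) (qN-homo-* 2 m))))
        (∑-applyH-inner c c0≡0))
      where
      eliminate : ∀ {n x c₁ s k h} → n ≡ qN 2 * k + 1ℚ → h ≡ c₁ + s - k * x →
        n * x - qN 2 * s ≡ x + qN 2 * c₁ - qN 2 * h
      eliminate {x = x} {c₁} {s} {k} refl refl =
        solve 4 (λ x c₁ s k → (con (qN 2) :* k :+ con 1ℚ) :* x :- con (qN 2) :* s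
                              := x :+ con (qN 2) :* c₁ :- con (qN 2) :* (c₁ :+ s :- k :* x)) refl x c₁ s k

  module Fibonacci (p : ℕ) where

    m N : ℕ
    m = suc p
    N = 2 ℕ.* m ℕ.+ 1

    open Entries m N using (φ; Λ)

    ℓ : ℚ
    ℓ = qN (L N)

    N≡3+2p : N ≡ 3 ℕ.+ 2 ℕ.* p
    N≡3+2p = trans (cong (ℕ._+ 1) (ℕP.*-suc 2 p)) (cong (2 ℕ.+_) (ℕP.+-comm (2 ℕ.* p) 1))

    φ-from-end : ∀ {k r} → k ℕ.+ r ≡ m → φ k ≡ qN (F (suc (2 ℕ.* r)))
    φ-from-end {k} {r} k+r≡m =
      cong (qN ∘ F) (subst (λ n → 2 ℕ.* n ℕ.+ 1 ∸ 2 ℕ.* k ≡ suc (2 ℕ.* r)) k+r≡m (2[k+r]+1∸2k k r))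

    φ-m≡1 : φ m ≡ 1ℚ
    φ-m≡1 = φ-from-end {m} {0} (ℕP.+-identityʳ m)

    φ-p≡2 : φ p ≡ qN 2
    φ-p≡2 = φ-from-end {p} {1} (ℕP.+-comm p 1)

    ∇φ≡0 : ∀ {q} → suc (suc q) ≤ m → ∇ φ q ≡ 0ℚ
    ∇φ≡0 {q} 2+q≤m = begin
      qN 3 * φ (suc q) - φ q - φ (suc (suc q))
        ≡⟨ cong₂ (λ a b → qN 3 * a - b - φ (suc (suc q))) (φ-offset {suc q} 1 e₁) (φ-offset {q} 2 e₀) ⟩
      qN 3 * Fq (2 ℕ.+ n) - Fq (4 ℕ.+ n) - φ (suc (suc q))
        ≡⟨ cong (λ x → qN 3 * Fq (2 ℕ.+ n) - Fq (4 ℕ.+ n) - x) (φ-offset {suc (suc q)} 0 e₂) ⟩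
      qN 3 * Fq (2 ℕ.+ n) - Fq (4 ℕ.+ n) - Fq n
        ≡⟨ a+c≡3b⇒∇≡0 (Fq (4 ℕ.+ n)) (Fq (2 ℕ.+ n)) (Fq n)
             (trans (ℚP.+-comm (Fq (4 ℕ.+ n)) (Fq n)) (gibonacci-skip {qN ∘ F} F-gibonacci n)) ⟩
      0ℚ ∎
      where
      Fq : ℕ → ℚ
      Fq = qN ∘ F
      r n : ℕ
      r = m ∸ suc (suc q)
      n = suc (2 ℕ.* r)
      φ-offset : ∀ {k} j → k ℕ.+ (j ℕ.+ r) ≡ m → φ k ≡ Fq (suc (2 ℕ.* j ℕ.+ 2 ℕ.* r))
      φ-offset {k} j e = trans (φ-from-end {k} {j ℕ.+ r} e) (cong (λ i → Fq (suc i)) (ℕP.*-distribˡ-+ 2 j r))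
      e₂ : suc (suc q) ℕ.+ r ≡ m
      e₂ = ℕP.m+[n∸m]≡n 2+q≤m
      e₁ : suc q ℕ.+ suc r ≡ m
      e₁ = trans (ℕP.+-suc (suc q) r) e₂
      e₀ : q ℕ.+ (2 ℕ.+ r) ≡ m
      e₀ = trans (ℕP.+-suc q (suc r)) e₁

    ∇Λ≡0 : ∀ q → ∇ Λ q ≡ 0ℚ
    ∇Λ≡0 q = begin
      qN 3 * Λ (suc q) - Λ q - Λ (suc (suc q))
        ≡⟨ cong₂ (λ a b → qN 3 * Lq a - Λ q - Lq b)
                 (ℕP.*-suc 2 q) (trans (ℕP.*-suc 2 (suc q)) (cong (2 ℕ.+_) (ℕP.*-suc 2 q))) ⟩
      qN 3 * Lq (2 ℕ.+ 2 ℕ.* q) - Lq (2 ℕ.* q) - Lq (4 ℕ.+ 2 ℕ.* q)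
        ≡⟨ a+c≡3b⇒∇≡0 (Lq (2 ℕ.* q)) (Lq (2 ℕ.+ 2 ℕ.* q)) (Lq (4 ℕ.+ 2 ℕ.* q))
             (gibonacci-skip {qN ∘ L} L-gibonacci (2 ℕ.* q)) ⟩
      0ℚ ∎
      where
      Lq : ℕ → ℚ
      Lq = qN ∘ L

    ℓ≡2Λm-Λp : ℓ ≡ qN 2 * Λ m - Λ p
    ℓ≡2Λm-Λp = begin
      qN (L N)                             ≡⟨ cong (qN ∘ L) N≡3+2p ⟩
      qN (L (3 ℕ.+ 2 ℕ.* p))               ≡⟨ gibonacci-3 {qN ∘ L} L-gibonacci (2 ℕ.* p) ⟩
      qN 2 * qN (L (2 ℕ.+ 2 ℕ.* p)) - Λ p  ≡⟨ cong (λ i → qN 2 * qN (L i) - Λ p) (sym (ℕP.*-suc 2 p)) ⟩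
      qN 2 * Λ m - Λ p                     ∎

    ℓ≡3F-2φ₁ : ℓ ≡ qN 3 * qN (F N) - qN 2 * φ 1
    ℓ≡3F-2φ₁ = begin
      qN (L N)                                   ≡⟨ cong (qN ∘ L) N≡3+2p ⟩
      qN (L (suc (suc n)))                       ≡⟨ cong qN (L≡F+F (suc n)) ⟩
      qN (F (suc n) ℕ.+ F (3 ℕ.+ n))             ≡⟨ qN-homo-+ (F (suc n)) (F (3 ℕ.+ n)) ⟩
      qN (F (suc n)) + qN (F (3 ℕ.+ n))          ≡⟨ combine (F-gibonacci n) (F-gibonacci (suc n)) ⟩
      qN 3 * qN (F (2 ℕ.+ n)) - qN 2 * qN (F n)
        ≡⟨ cong₂ (λ i x → qN 3 * qN (F i) - qN 2 * x) (sym N≡3+2p) (sym (φ-from-end {1} {p} refl)) ⟩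
      qN 3 * qN (F N) - qN 2 * φ 1               ∎
      where
      n : ℕ
      n = suc (2 ℕ.* p)
      combine : ∀ {a b c d} → c ≡ a + b → d ≡ c + a → a + d ≡ qN 3 * c - qN 2 * b
      combine {a} {b} refl refl =
        solve 2 (λ a b → a :+ (a :+ b :+ a) := con (qN 3) :* (a :+ b) :- con (qN 2) :* b) refl a b

    L≡F[N∸1]+F[1+N] : L N ≡ F (N ∸ 1) ℕ.+ F (suc N)
    L≡F[N∸1]+F[1+N] = subst (λ n → L n ≡ F (n ∸ 1) ℕ.+ F (suc n)) (sym N≡3+2p) (L≡F+F (2 ℕ.+ 2 ℕ.* p))

    casoratian : ℕ → ℚ
    casoratian b = φ b * Λ (suc b) - φ (suc b) * Λ b

    casoratian-step : ∀ {b} → suc (suc b) ≤ m → casoratian b ≡ casoratian (suc b)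
    casoratian-step {b} 2+b≤m = step {φ b} {φ (suc b)} {φ (suc (suc b))} {Λ b} {Λ (suc b)} {Λ (suc (suc b))}
      (∇≡0⇒ {φ} {b} (∇φ≡0 2+b≤m)) (∇≡0⇒ {Λ} {b} (∇Λ≡0 b))
      where
      step : ∀ {φ₀ φ₁ φ₂ Λ₀ Λ₁ Λ₂} → φ₀ ≡ qN 3 * φ₁ - φ₂ → Λ₀ ≡ qN 3 * Λ₁ - Λ₂ →
        φ₀ * Λ₁ - φ₁ * Λ₀ ≡ φ₁ * Λ₂ - φ₂ * Λ₁
      step {φ₁ = φ₁} {φ₂} {Λ₁ = Λ₁} {Λ₂} refl refl =
        solve 4 (λ φ₁ φ₂ Λ₁ Λ₂ → (con (qN 3) :* φ₁ :- φ₂) :* Λ₁ :- φ₁ :* (con (qN 3) :* Λ₁ :- Λ₂)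
                                := φ₁ :* Λ₂ :- φ₂ :* Λ₁) refl φ₁ φ₂ Λ₁ Λ₂

    casoratian-p≡ℓ : casoratian p ≡ ℓ
    casoratian-p≡ℓ = begin
      φ p * Λ m - φ m * Λ p  ≡⟨ cong₂ (λ a b → a * Λ m - b * Λ p) φ-p≡2 φ-m≡1 ⟩
      qN 2 * Λ m - 1ℚ * Λ p  ≡⟨ cong (λ x → qN 2 * Λ m - x) (ℚP.*-identityˡ (Λ p)) ⟩
      qN 2 * Λ m - Λ p       ≡⟨ sym ℓ≡2Λm-Λp ⟩
      ℓ                      ∎

    casoratian≡ℓ : ∀ {b} → b < m → casoratian b ≡ ℓ
    casoratian≡ℓ {b} b<m = from-distance {b} {p ∸ b} (ℕP.m+[n∸m]≡n (ℕP.≤-pred b<m))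
      where
      from-distance : ∀ {b r} → b ℕ.+ r ≡ p → casoratian b ≡ ℓ
      from-distance {b} {zero} b+0≡p =
        subst (λ x → casoratian x ≡ ℓ) (sym (trans (sym (ℕP.+-identityʳ b)) b+0≡p)) casoratian-p≡ℓ
      from-distance {b} {suc r} b+1+r≡p = trans (casoratian-step (s≤s (subst (suc b ≤_) b+1+r≡p 1+b≤b+1+r)))
        (from-distance {suc b} {r} (trans (sym (ℕP.+-suc b r)) b+1+r≡p))
        where
        1+b≤b+1+r : suc b ≤ b ℕ.+ suc r
        1+b≤b+1+r = subst (suc b ≤_) (sym (ℕP.+-suc b r)) (s≤s (ℕP.m≤m+n b r))

  module Inverse (p : ℕ) where

    open Fibonacci p
    open Entries m N
    open Rows p N hiding (m)

    f : ℚ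
    f = qN (F N)

    col : ℕ → ℕ → ℚ
    col b x = Centry m N x b

    col-0 : ∀ {b} → b ≤ suc m → col b 0 ≡ 0ℚ
    col-0 b≤1+m = by-cases (≤1+n-split b≤1+m)
      where
      by-cases : ∀ {b} → b ≤ m ⊎ b ≡ suc m → col b 0 ≡ 0ℚ
      by-cases {b} (inj₁ b≤m) = trans (Centry-≤ z≤n b≤m)
        (solve 2 (λ f y → con (qN 2) :* (f :- f) :+ y :* (con (qN 2) :- con (qN 2)) := con 0ℚ) refl f (φ b))
      by-cases (inj₂ refl) = trans (Centry-lastcol z≤n) (ℚP.+-inverseʳ f)

    on-diagonal : ∀ {a x} → x ≡ ℓ → x ≡ δ a a * ℓ
    on-diagonal {a} x≡ℓ = trans x≡ℓ (sym (trans (cong (_* ℓ) (δ-refl a)) (ℚP.*-identityˡ ℓ)))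

    off-diagonal : ∀ {a b x} → a ≢ b → x ≡ 0ℚ → x ≡ δ a b * ℓ
    off-diagonal a≢b x≡0 = trans x≡0 (sym (trans (cong (_* ℓ) (δ-≢ a≢b)) (ℚP.*-zeroˡ ℓ)))

    rowA-vanishes : ∀ {q b} → suc q < m → b ≤ m → ∇ (col b) q ≡ qN 2 * (f - φ b) → applyH (col b) (suc q) ≡ 0ℚ
    rowA-vanishes {q} {b} 1+q<m b≤m ∇≡ = begin
      applyH (col b) (suc q)               ≡⟨ applyH-rowA (col b) (col-0 (ℕP.m≤n⇒m≤1+n b≤m)) 1+q<m ⟩
      ∇ (col b) q - col b (suc m)          ≡⟨ cong₂ _-_ ∇≡ (Centry-lastrow b≤m) ⟩
      qN 2 * (f - φ b) - qN 2 * (f - φ b)  ≡⟨ ℚP.+-inverseʳ (qN 2 * (f - φ b)) ⟩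
      0ℚ                                   ∎

    rowA-left : ∀ {q b} → suc q < m → b ≤ q → applyH (col b) (suc q) ≡ 0ℚ
    rowA-left {q} {b} 1+q<m b≤q = rowA-vanishes 1+q<m b≤m
      (∇-affine {col b} {φ} {Λ} {q} (qN 2 * (f - φ b)) (Λ b - qN 2) 0ℚ (∇φ≡0 1+q<m) (∇Λ≡0 q) affine)
      where
      b≤m : b ≤ m
      b≤m = ℕP.≤-trans b≤q (ℕP.<⇒≤ (ℕP.<-trans (ℕP.n<1+n q) 1+q<m))
      affine : ∀ {k} → q ≤ k → k ≤ suc (suc q) → col b k ≡ qN 2 * (f - φ b) + (Λ b - qN 2) * φ k + 0ℚ * Λ k
      affine {k} q≤k k≤2+q = trans (Centry-≥ (ℕP.≤-trans b≤q q≤k) (ℕP.≤-trans k≤2+q 1+q<m))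
        (solve 4 (λ α y φk Λk → α :+ φk :* y := α :+ y :* φk :+ con 0ℚ :* Λk) refl
           (qN 2 * (f - φ b)) (Λ b - qN 2) (φ k) (Λ k))

    rowA-right : ∀ {q b} → suc q < m → suc q < b → b ≤ m → applyH (col b) (suc q) ≡ 0ℚ
    rowA-right {q} {b} 1+q<m 1+q<b b≤m = rowA-vanishes 1+q<m b≤m
      (∇-affine {col b} {φ} {Λ} {q} (qN 2 * (f - φ b)) (- qN 2) (φ b) (∇φ≡0 1+q<m) (∇Λ≡0 q) affine)
      where
      affine : ∀ {k} → q ≤ k → k ≤ suc (suc q) → col b k ≡ qN 2 * (f - φ b) + (- qN 2) * φ k + φ b * Λ k
      affine {k} q≤k k≤2+q = trans (Centry-≤ (ℕP.≤-trans k≤2+q 1+q<b) b≤m)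
        (solve 4 (λ f φk φb Λk → con (qN 2) :* (f :- φk) :+ φb :* (Λk :- con (qN 2))
                                := con (qN 2) :* (f :- φb) :+ con (- qN 2) :* φk :+ φb :* Λk) refl
           f (φ k) (φ b) (Λ k))

    rowA-lastcol : ∀ {q} → suc q < m → applyH (col (suc m)) (suc q) ≡ 0ℚ
    rowA-lastcol {q} 1+q<m = begin
      applyH (col (suc m)) (suc q)
        ≡⟨ applyH-rowA (col (suc m)) (col-0 ℕP.≤-refl) 1+q<m ⟩
      ∇ (col (suc m)) q - col (suc m) (suc m)
        ≡⟨ cong₂ _-_ (∇-affine {col (suc m)} {φ} {Λ} {q} f (- 1ℚ) 0ℚ (∇φ≡0 1+q<m) (∇Λ≡0 q) affine)
                     Centry-corner ⟩
      f - f
        ≡⟨ ℚP.+-inverseʳ f ⟩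
      0ℚ ∎
      where
      affine : ∀ {k} → q ≤ k → k ≤ suc (suc q) → col (suc m) k ≡ f + (- 1ℚ) * φ k + 0ℚ * Λ k
      affine {k} _ k≤2+q = trans (Centry-lastcol (ℕP.≤-trans k≤2+q 1+q<m))
        (solve 3 (λ f φk Λk → f :- φk := f :+ con (- 1ℚ) :* φk :+ con 0ℚ :* Λk) refl f (φ k) (Λ k))

    rowA-diagonal : ∀ {q} → suc q < m → applyH (col (suc q)) (suc q) ≡ ℓ
    rowA-diagonal {q} 1+q<m = begin
      applyH (col b) b
        ≡⟨ applyH-rowA (col b) (col-0 (ℕP.m≤n⇒m≤1+n b≤m)) 1+q<m ⟩
      qN 3 * col b b - col b q - col b (suc b) - col b (suc m)
        ≡⟨ cong₂ _-_ (cong₂ _-_ (cong₂ (λ x y → qN 3 * x - y)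
                                       (Centry-≤ ℕP.≤-refl b≤m) (Centry-≤ (ℕP.n≤1+n q) b≤m))
                                (Centry-≥ (ℕP.n≤1+n b) 1+q<m))
                     (Centry-lastrow b≤m) ⟩
      qN 3 * G b b - G q b - G b (suc b) - qN 2 * (f - φ b)
        ≡⟨ kink (∇≡0⇒ {φ} {q} (∇φ≡0 1+q<m)) (∇≡0⇒ {Λ} {q} (∇Λ≡0 q)) ⟩
      casoratian b
        ≡⟨ casoratian≡ℓ {b} 1+q<m ⟩
      ℓ ∎
      where
      b : ℕ
      b = suc q
      b≤m : b ≤ m
      b≤m = ℕP.<⇒≤ 1+q<m
      kink : ∀ {φ₀ φ₁ φ₂ Λ₀ Λ₁ Λ₂} → φ₀ ≡ qN 3 * φ₁ - φ₂ → Λ₀ ≡ qN 3 * Λ₁ - Λ₂ →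
        qN 3 * (qN 2 * (f - φ₁) + φ₁ * (Λ₁ - qN 2)) - (qN 2 * (f - φ₀) + φ₁ * (Λ₀ - qN 2))
          - (qN 2 * (f - φ₁) + φ₂ * (Λ₁ - qN 2)) - qN 2 * (f - φ₁) ≡ φ₁ * Λ₂ - φ₂ * Λ₁
      kink {φ₁ = φ₁} {φ₂} {Λ₁ = Λ₁} {Λ₂} refl refl =
        solve 5 (λ f φ₁ φ₂ Λ₁ Λ₂ →
          con (qN 3) :* (con (qN 2) :* (f :- φ₁) :+ φ₁ :* (Λ₁ :- con (qN 2)))
          :- (con (qN 2) :* (f :- (con (qN 3) :* φ₁ :- φ₂)) :+ φ₁ :* ((con (qN 3) :* Λ₁ :- Λ₂) :- con (qN 2)))
          :- (con (qN 2) :* (f :- φ₁) :+ φ₂ :* (Λ₁ :- con (qN 2))) :- con (qN 2) :* (f :- φ₁)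
          := φ₁ :* Λ₂ :- φ₂ :* Λ₁) refl f φ₁ φ₂ Λ₁ Λ₂

    rowB-left : ∀ {b} → b ≤ p → applyH (col b) m ≡ 0ℚ
    rowB-left {b} b≤p = begin
      applyH (col b) m
        ≡⟨ applyH-rowB (col b) (col-0 (ℕP.m≤n⇒m≤1+n b≤m)) ⟩
      qN 2 * col b m - col b p - col b (suc m)
        ≡⟨ cong₂ _-_ (cong₂ (λ x y → qN 2 * x - y) (Centry-≥ b≤m ℕP.≤-refl) (Centry-≥ b≤p (ℕP.n≤1+n p)))
                     (Centry-lastrow b≤m) ⟩
      qN 2 * G b m - G b p - qN 2 * (f - φ b)
        ≡⟨ boundary φ-p≡2 φ-m≡1 ⟩
      0ℚ ∎
      where
      b≤m : b ≤ m
      b≤m = ℕP.m≤n⇒m≤1+n b≤p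
      boundary : ∀ {φp φm} → φp ≡ qN 2 → φm ≡ 1ℚ →
        qN 2 * (qN 2 * (f - φ b) + φm * (Λ b - qN 2)) - (qN 2 * (f - φ b) + φp * (Λ b - qN 2))
          - qN 2 * (f - φ b) ≡ 0ℚ
      boundary refl refl = solve 3 (λ f φb Λb →
        con (qN 2) :* (con (qN 2) :* (f :- φb) :+ con 1ℚ :* (Λb :- con (qN 2)))
        :- (con (qN 2) :* (f :- φb) :+ con (qN 2) :* (Λb :- con (qN 2))) :- con (qN 2) :* (f :- φb)
        := con 0ℚ) refl f (φ b) (Λ b)

    rowB-diagonal : applyH (col m) m ≡ ℓ
    rowB-diagonal = begin
      applyH (col m) m
        ≡⟨ applyH-rowB (col m) (col-0 (ℕP.n≤1+n m)) ⟩
      qN 2 * col m m - col m p - col m (suc m)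
        ≡⟨ cong₂ _-_ (cong₂ (λ x y → qN 2 * x - y)
                            (Centry-≤ ℕP.≤-refl ℕP.≤-refl) (Centry-≤ (ℕP.n≤1+n p) ℕP.≤-refl))
                     (Centry-lastrow ℕP.≤-refl) ⟩
      qN 2 * G m m - G p m - qN 2 * (f - φ m)
        ≡⟨ boundary φ-p≡2 φ-m≡1 ⟩
      qN 2 * Λ m - Λ p
        ≡⟨ sym ℓ≡2Λm-Λp ⟩
      ℓ ∎
      where
      boundary : ∀ {φp φm} → φp ≡ qN 2 → φm ≡ 1ℚ →
        qN 2 * (qN 2 * (f - φm) + φm * (Λ m - qN 2)) - (qN 2 * (f - φp) + φm * (Λ p - qN 2))
          - qN 2 * (f - φm) ≡ qN 2 * Λ m - Λ p
      boundary refl refl = solve 3 (λ f Λm Λp →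
        con (qN 2) :* (con (qN 2) :* (f :- con 1ℚ) :+ con 1ℚ :* (Λm :- con (qN 2)))
        :- (con (qN 2) :* (f :- con (qN 2)) :+ con 1ℚ :* (Λp :- con (qN 2))) :- con (qN 2) :* (f :- con 1ℚ)
        := con (qN 2) :* Λm :- Λp) refl f (Λ m) (Λ p)

    rowB-lastcol : applyH (col (suc m)) m ≡ 0ℚ
    rowB-lastcol = begin
      applyH (col (suc m)) m
        ≡⟨ applyH-rowB (col (suc m)) (col-0 ℕP.≤-refl) ⟩
      qN 2 * col (suc m) m - col (suc m) p - col (suc m) (suc m)
        ≡⟨ cong₂ _-_ (cong₂ (λ x y → qN 2 * x - y) (Centry-lastcol ℕP.≤-refl) (Centry-lastcol (ℕP.n≤1+n p)))
                     Centry-corner ⟩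
      qN 2 * (f - φ m) - (f - φ p) - f
        ≡⟨ boundary φ-p≡2 φ-m≡1 ⟩
      0ℚ ∎
      where
      boundary : ∀ {φp φm} → φp ≡ qN 2 → φm ≡ 1ℚ → qN 2 * (f - φm) - (f - φp) - f ≡ 0ℚ
      boundary refl refl =
        solve 1 (λ f → con (qN 2) :* (f :- con 1ℚ) :- (f :- con (qN 2)) :- f := con 0ℚ) refl f

    H·C-rowA : ∀ {q b} → suc q < m → b ≤ suc m → applyH (col b) (suc q) ≡ δ (suc q) b * ℓ
    H·C-rowA {q} 1+q<m b≤1+m = by-cases (≤1+n-split b≤1+m)
      where
      inner : ∀ {b} → b ≤ m → Tri (b < suc q) (b ≡ suc q) (suc q < b) →
        applyH (col b) (suc q) ≡ δ (suc q) b * ℓ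
      inner _ (tri< b<1+q _ _) = off-diagonal (ℕP.>⇒≢ b<1+q) (rowA-left 1+q<m (ℕP.≤-pred b<1+q))
      inner _ (tri≈ _ refl _) = on-diagonal {suc q} (rowA-diagonal 1+q<m)
      inner b≤m (tri> _ _ 1+q<b) = off-diagonal (ℕP.<⇒≢ 1+q<b) (rowA-right 1+q<m 1+q<b b≤m)
      by-cases : ∀ {b} → b ≤ m ⊎ b ≡ suc m → applyH (col b) (suc q) ≡ δ (suc q) b * ℓ
      by-cases {b} (inj₁ b≤m) = inner b≤m (ℕP.<-cmp b (suc q))
      by-cases (inj₂ refl) = off-diagonal (ℕP.<⇒≢ (ℕP.m<n⇒m<1+n 1+q<m)) (rowA-lastcol 1+q<m)

    H·C-rowB : ∀ {b} → b ≤ suc m → applyH (col b) m ≡ δ m b * ℓ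
    H·C-rowB b≤1+m = by-cases (≤1+n-split b≤1+m)
      where
      inner : ∀ {b} → b < m ⊎ b ≡ m → applyH (col b) m ≡ δ m b * ℓ
      inner (inj₁ b<m) = off-diagonal (ℕP.>⇒≢ b<m) (rowB-left (ℕP.≤-pred b<m))
      inner (inj₂ refl) = on-diagonal {m} rowB-diagonal
      by-cases : ∀ {b} → b ≤ m ⊎ b ≡ suc m → applyH (col b) m ≡ δ m b * ℓ
      by-cases (inj₁ b≤m) = inner (ℕP.m≤n⇒m<n∨m≡n b≤m)
      by-cases (inj₂ refl) = off-diagonal (n≢1+n m) rowB-lastcol

    H·C-inner : ∀ {a b} → 1 ≤ a → a ≤ m → b ≤ suc m → applyH (col b) a ≡ δ a b * ℓ
    H·C-inner (s≤s z≤n) (s≤s q≤p) b≤1+m = by-cases (ℕP.m≤n⇒m<n∨m≡n q≤p) b≤1+m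
      where
      by-cases : ∀ {q b} → q < p ⊎ q ≡ p → b ≤ suc m → applyH (col b) (suc q) ≡ δ (suc q) b * ℓ
      by-cases (inj₁ q<p) = H·C-rowA (s≤s q<p)
      by-cases (inj₂ refl) = H·C-rowB

    H·C-last : ∀ {b} → 1 ≤ b → b ≤ suc m → applyH (col b) (suc m) ≡ δ (suc m) b * ℓ
    H·C-last {b} 1≤b b≤1+m = begin
      applyH (col b) (suc m)
        ≡⟨ applyH-last-telescoped refl (col b) (col-0 b≤1+m) ⟩
      col b (suc m) + qN 2 * col b 1 - qN 2 * ∑< m (λ k → applyH (col b) (suc k))
        ≡⟨ cong (λ s → col b (suc m) + qN 2 * col b 1 - qN 2 * s)
                (∑<-cong m (λ k k<m → H·C-inner (s≤s z≤n) k<m b≤1+m)) ⟩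
      col b (suc m) + qN 2 * col b 1 - qN 2 * ∑< m (λ k → δ (suc k) b * ℓ)
        ≡⟨ by-cases 1≤b (≤1+n-split b≤1+m) ⟩
      δ (suc m) b * ℓ ∎
      where
      by-cases : ∀ {b} → 1 ≤ b → b ≤ m ⊎ b ≡ suc m →
        col b (suc m) + qN 2 * col b 1 - qN 2 * ∑< m (λ k → δ (suc k) b * ℓ) ≡ δ (suc m) b * ℓ
      by-cases {suc b} (s≤s z≤n) (inj₁ b<m) = off-diagonal (ℕP.>⇒≢ (s≤s b<m)) (begin
        col (suc b) (suc m) + qN 2 * col (suc b) 1 - qN 2 * ∑< m (λ k → δ k b * ℓ)
          ≡⟨ cong₂ (λ x y → x + qN 2 * y - qN 2 * ∑< m (λ k → δ k b * ℓ))
                   (Centry-lastrow b<m) (Centry-≤ (s≤s z≤n) b<m) ⟩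
        qN 2 * (f - φ (suc b)) + qN 2 * G 1 (suc b) - qN 2 * ∑< m (λ k → δ k b * ℓ)
          ≡⟨ cong (λ s → qN 2 * (f - φ (suc b)) + qN 2 * G 1 (suc b) - qN 2 * s)
                  (trans (∑<-δ m b (λ _ → ℓ) b<m) ℓ≡3F-2φ₁) ⟩
        qN 2 * (f - φ (suc b)) + qN 2 * G 1 (suc b) - qN 2 * (qN 3 * f - qN 2 * φ 1)
          ≡⟨ solve 3 (λ f φb φ₁ →
               con (qN 2) :* (f :- φb)
               :+ con (qN 2) :* (con (qN 2) :* (f :- φ₁) :+ φb :* (con (qN 3) :- con (qN 2)))
               :- con (qN 2) :* (con (qN 3) :* f :- con (qN 2) :* φ₁) := con 0ℚ) refl f (φ (suc b)) (φ 1) ⟩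
        0ℚ ∎)
      by-cases (s≤s z≤n) (inj₂ refl) = on-diagonal {suc m} (begin
        col (suc m) (suc m) + qN 2 * col (suc m) 1 - qN 2 * ∑< m (λ k → δ k m * ℓ)
          ≡⟨ cong₂ (λ x y → x + qN 2 * y - qN 2 * ∑< m (λ k → δ k m * ℓ))
                   Centry-corner (Centry-lastcol (s≤s z≤n)) ⟩
        f + qN 2 * (f - φ 1) - qN 2 * ∑< m (λ k → δ k m * ℓ)
          ≡⟨ cong (λ s → f + qN 2 * (f - φ 1) - qN 2 * s)
                  (trans (∑<-cong m (λ k k<m → trans (cong (_* ℓ) (δ-≢ (ℕP.<⇒≢ k<m))) (ℚP.*-zeroˡ ℓ)))
                         (∑<-0 m)) ⟩
        f + qN 2 * (f - φ 1) - qN 2 * 0ℚ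
          ≡⟨ solve 2 (λ f φ₁ → f :+ con (qN 2) :* (f :- φ₁) :- con (qN 2) :* con 0ℚ
                              := con (qN 3) :* f :- con (qN 2) :* φ₁) refl f (φ 1) ⟩
        qN 3 * f - qN 2 * φ 1
          ≡⟨ sym ℓ≡3F-2φ₁ ⟩
        ℓ ∎)

    H·C≡ℓδ : ∀ {a b} → 1 ≤ a → a ≤ suc m → 1 ≤ b → b ≤ suc m → applyH (col b) a ≡ δ a b * ℓ
    H·C≡ℓδ {b = b} 1≤a a≤1+m 1≤b b≤1+m = by-cases 1≤a (≤1+n-split a≤1+m)
      where
      by-cases : ∀ {a} → 1 ≤ a → a ≤ m ⊎ a ≡ suc m → applyH (col b) a ≡ δ a b * ℓ
      by-cases 1≤a (inj₁ a≤m) = H·C-inner 1≤a a≤m b≤1+m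
      by-cases _ (inj₂ refl) = H·C-last 1≤b b≤1+m

    u : ℚ
    u = ((ℤ.+ 1) ℚ./ (F (N ∸ 1) ℕ.+ F (suc N))) {{den-nonZero N}}

    u*ℓ≡1 : u * ℓ ≡ 1ℚ
    u*ℓ≡1 = trans (cong (λ n → u * qN n) L≡F[N∸1]+F[1+N]) (1/n*n≡1 (F (N ∸ 1) ℕ.+ F (suc N)) {{den-nonZero N}})

    H⊗Hinv≡Id : ∀ i j → (H m N ⊗ Hinv m N) i j ≡ Id i j
    H⊗Hinv≡Id i j = begin
      (H m N ⊗ Hinv m N) i j
        ≡⟨ ∑-toℕ (suc m) (λ k → Hentry m N a (suc k) * (u * col b (suc k))) ⟩
      ∑< (suc m) (λ k → Hentry m N a (suc k) * (u * col b (suc k)))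
        ≡⟨ ∑<-cong (suc m) (λ k _ → swap (Hentry m N a (suc k)) (col b (suc k))) ⟩
      ∑< (suc m) (λ k → u * (Hentry m N a (suc k) * col b (suc k)))
        ≡⟨ sym (*-distribˡ-∑< (suc m) u (λ k → Hentry m N a (suc k) * col b (suc k))) ⟩
      u * applyH (col b) a
        ≡⟨ cong (u *_) (H·C≡ℓδ (s≤s z≤n) (FinP.toℕ<n i) (s≤s z≤n) (FinP.toℕ<n j)) ⟩
      u * (δ a b * ℓ)
        ≡⟨ solve 3 (λ u d l → u :* (d :* l) := d :* (u :* l)) refl u (δ a b) ℓ ⟩
      δ a b * (u * ℓ)
        ≡⟨ cong (δ a b *_) u*ℓ≡1 ⟩
      δ a b * 1ℚ
        ≡⟨ ℚP.*-identityʳ (δ a b) ⟩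
      Id i j ∎
      where
      a b : ℕ
      a = suc (toℕ i)
      b = suc (toℕ j)
      swap : ∀ h c → h * (u * c) ≡ u * (h * c)
      swap h c = solve 3 (λ h c u → h :* (u :* c) := u :* (h :* c)) refl h c u

    Hinv⊗H≡Id : ∀ i j → (Hinv m N ⊗ H m N) i j ≡ Id i j
    Hinv⊗H≡Id = ⊗-inverse-swap weight (λ i → w-nonZero (suc (toℕ i))) {H m N} {Hinv m N}
      H-scaled Hinv-scaled H⊗Hinv≡Id
      where
      weight : Fin (suc m) → ℚ
      weight i = w (suc (toℕ i))
      H-scaled : ScaledSymmetric weight (H m N)
      H-scaled i j = H-scaledSymmetric (s≤s z≤n) (FinP.toℕ<n i) (s≤s z≤n) (FinP.toℕ<n j)
      Hinv-scaled : ScaledSymmetric weight (Hinv m N)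
      Hinv-scaled i j = trans (ℚP.*-assoc u _ _)
        (trans (cong (u *_) (C-scaledSymmetric (FinP.toℕ<n i) (FinP.toℕ<n j))) (sym (ℚP.*-assoc u _ _)))

open import Data.Nat using (_+_; _*_)

proposition1 : (m N : ℕ) → N ≡ 2 * m + 1 → 3 ≤ N →
    (∀ i j → (H m N ⊗ Hinv m N) i j ≡ Id i j) × (∀ i j → (Hinv m N ⊗ H m N) i j ≡ Id i j)
proposition1 zero .1 refl (s≤s ())
proposition1 (suc p) .(2 * suc p + 1) refl _ = H⊗Hinv≡Id , Hinv⊗H≡Id
  where open Inverse p
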